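{- Let $G$ be a graph with $E(G)\neq\emptyset$. If for every metrizable weight $w:E(G)\to[0,\infty)$ the poset $(\mathfrak M_w,\leqslant)$ contains a least element, then $G$ is connected.
   Context: Graphs are simple, possibly infinite. A weight $w$ is metrizable if there is a pseudometric $d$ on $V(G)$ with $d(u,v)=w(\{u,v\})$ for all edges $\{u,v\}$. $\mathfrak M_w$ is the set of all pseudometrics $\rho$ on $V(G)$ with $\rho(u,v)=w(\{u,v\})$ for all $\{u,v\}\in E(G)$, ordered by $\rho_1\leqslant\rho_2$ iff $\rho_1(u,v)\le\rho_2(u,v)$ for all $u,v\in V(G)$. -}

module Defs where

open import Level using (0ℓ)
open import Data.Sum using (_⊎_)
open import Data.Product using (Σ; ∃; _×_; _,_)
open import Relation.Binary.PropositionalEquality using (_≡_; _≢_)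
open import Relation.Nullary using (¬_)
open import Relation.Binary.Construct.Closure.ReflexiveTransitive using (Star)

-- The real numbers, axiomatised as a Dedekind-complete ordered field
-- (unique up to isomorphism, so this is ℝ).
record RealNumbers : Set₁ where
  infixl 6 _+_
  infixl 7 _*_
  infix 4 _≤_
  field
    Carrier : Set
    _+_ _*_ : Carrier → Carrier → Carrier
    -_ : Carrier → Carrier
    0ℝ 1ℝ : Carrier
    _≤_ : Carrier → Carrier → Set
    +-assoc : ∀ x y z → (x + y) + z ≡ x + (y + z)
    +-comm : ∀ x y → x + y ≡ y + x
    +-identityˡ : ∀ x → 0ℝ + x ≡ x
    +-inverseʳ : ∀ x → x + (- x) ≡ 0ℝ
    *-assoc : ∀ x y z → (x * y) * z ≡ x * (y * z)
    *-comm : ∀ x y → x * y ≡ y * x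
    *-identityˡ : ∀ x → 1ℝ * x ≡ x
    distribˡ : ∀ x y z → x * (y + z) ≡ (x * y) + (x * z)
    0≢1 : 0ℝ ≢ 1ℝ
    *-inverse : ∀ x → x ≢ 0ℝ → Σ Carrier (λ y → x * y ≡ 1ℝ)
    ≤-refl : ∀ x → x ≤ x
    ≤-trans : ∀ {x y z} → x ≤ y → y ≤ z → x ≤ z
    ≤-antisym : ∀ {x y} → x ≤ y → y ≤ x → x ≡ y
    ≤-total : ∀ x y → (x ≤ y) ⊎ (y ≤ x)
    +-monoˡ-≤ : ∀ {x y} z → x ≤ y → x + z ≤ y + z
    *-nonneg : ∀ {x y} → 0ℝ ≤ x → 0ℝ ≤ y → 0ℝ ≤ x * y
    sup : (P : Carrier → Set) → ∃ P → ∃ (λ b → ∀ x → P x → x ≤ b) →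
          ∃ (λ s → (∀ x → P x → x ≤ s) × (∀ b → (∀ x → P x → x ≤ b) → s ≤ b))

-- A simple graph (possibly infinite): symmetric irreflexive adjacency.
-- An edge {u,v} is witnessed by Adj u v (equivalently Adj v u).
record SimpleGraph : Set₁ where
  field
    V : Set
    Adj : V → V → Set
    Adj-sym : ∀ {u v} → Adj u v → Adj v u
    Adj-irrefl : ∀ {u} → ¬ Adj u u

module _ (ℝ : RealNumbers) (G : SimpleGraph) where
  open RealNumbers ℝ
  open SimpleGraph G

  -- weights E(G) → ℝ (given on each adjacency witness; a metrizable
  -- weight is automatically symmetric and witness-independent)
  Weight : Set
  Weight = ∀ {u v} → Adj u v → Carrier

  NonNegative : Weight → Set
  NonNegative w = ∀ {u v} (e : Adj u v) → 0ℝ ≤ w e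

  IsPseudometric : (V → V → Carrier) → Set
  IsPseudometric ρ = (∀ x → ρ x x ≡ 0ℝ)
                   × (∀ x y → ρ x y ≡ ρ y x)
                   × (∀ x y z → ρ x z ≤ ρ x y + ρ y z)

  In𝔐 : Weight → (V → V → Carrier) → Set
  In𝔐 w ρ = IsPseudometric ρ × (∀ {u v} (e : Adj u v) → ρ u v ≡ w e)

  Metrizable : Weight → Set
  Metrizable w = ∃ (λ ρ → In𝔐 w ρ)

  _⩽_ : (V → V → Carrier) → (V → V → Carrier) → Set
  ρ₁ ⩽ ρ₂ = ∀ u v → ρ₁ u v ≤ ρ₂ u v

  HasLeast𝔐 : Weight → Set
  HasLeast𝔐 w = ∃ (λ ρ → In𝔐 w ρ × (∀ ρ' → In𝔐 w ρ' → ρ ⩽ ρ'))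

module _ (G : SimpleGraph) where
  open SimpleGraph G

  EdgeSetNonempty : Set
  EdgeSetNonempty = ∃ (λ u → ∃ (λ v → Adj u v))

  Connected : Set
  Connected = ∀ u v → Star Adj u v

module Submission where

open import Defs
open import Level using (0ℓ)
open import Axiom.ExcludedMiddle using (ExcludedMiddle)
open import Data.Sum using (inj₁; inj₂)
open import Data.Product using (∃; _×_; _,_)
open import Data.Empty using (⊥-elim)
open import Relation.Nullary using (¬_; yes; no)
open import Relation.Binary.Bundles using (Poset)
open import Relation.Binary.PropositionalEquality
  using (_≡_; _≢_; refl; sym; cong; cong₂; isEquivalence)
open import Relation.Binary.Construct.Closure.ReflexiveTransitive
  using (Star; ε; _◅_; _◅◅_; reverse)

-- Fix an edge ab and suppose some vertex lies outside the component K of a.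
-- Collapsing everything outside K to one vertex t and pulling back the
-- discrete metric gives a pseudometric ρₜ; on every edge ρₜ does not depend
-- on t, so ρₐ and ρ_b lie in the same 𝔐_w. A least element ρ of 𝔐_w is
-- below both, so for x ∉ K we get ρ(a,x) ≤ ρₐ(a,x) = 0 and
-- ρ(x,b) ≤ ρ_b(x,b) = 0, whence ρ(a,b) = 0, contradicting ρ(a,b) = w(ab) ≠ 0.

module OrderedField (ℝ : RealNumbers) where
  open RealNumbers ℝ

  poset : Poset 0ℓ 0ℓ 0ℓ
  poset = record
    { _≈_ = _≡_
    ; _≤_ = _≤_
    ; isPartialOrder = record
      { isPreorder = record
        { isEquivalence = isEquivalence
        ; reflexive = λ { refl → ≤-refl _ }
        ; trans = ≤-trans
        }
      ; antisym = ≤-antisym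
      }
    }

  open import Relation.Binary.Reasoning.PartialOrder poset public

  +-identityʳ : ∀ x → x + 0ℝ ≡ x
  +-identityʳ x = begin-equality
    x + 0ℝ ≡⟨ +-comm x 0ℝ ⟩
    0ℝ + x ≡⟨ +-identityˡ x ⟩
    x      ∎

  x≤x+y : ∀ {x y} → 0ℝ ≤ y → x ≤ x + y
  x≤x+y {x} {y} 0≤y = begin
    x      ≡⟨ +-identityˡ x ⟨
    0ℝ + x ≤⟨ +-monoˡ-≤ x 0≤y ⟩
    y + x  ≡⟨ +-comm y x ⟩
    x + y  ∎

  +-nonpos : ∀ {x y} → x ≤ 0ℝ → y ≤ 0ℝ → x + y ≤ 0ℝ
  +-nonpos {x} {y} x≤0 y≤0 = begin
    x + y  ≤⟨ +-monoˡ-≤ y x≤0 ⟩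
    0ℝ + y ≡⟨ +-identityˡ y ⟩
    y      ≤⟨ y≤0 ⟩
    0ℝ     ∎

  -- Either 1 or -1, whichever is nonnegative.
  ∃-nonneg-nonzero : ∃ λ c → 0ℝ ≤ c × c ≢ 0ℝ
  ∃-nonneg-nonzero with ≤-total 0ℝ 1ℝ
  ... | inj₁ 0≤1 = 1ℝ , 0≤1 , λ 1≡0 → 0≢1 (sym 1≡0)
  ... | inj₂ 1≤0 = - 1ℝ , 0≤-1 , -1≢0
    where
    0≤-1 : 0ℝ ≤ - 1ℝ
    0≤-1 = begin
      0ℝ          ≡⟨ +-inverseʳ 1ℝ ⟨
      1ℝ + - 1ℝ   ≤⟨ +-monoˡ-≤ (- 1ℝ) 1≤0 ⟩
      0ℝ + - 1ℝ   ≡⟨ +-identityˡ (- 1ℝ) ⟩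
      - 1ℝ        ∎
    -1≢0 : - 1ℝ ≢ 0ℝ
    -1≢0 -1≡0 = 0≢1 (begin-equality
      0ℝ          ≡⟨ +-inverseʳ 1ℝ ⟨
      1ℝ + - 1ℝ   ≡⟨ cong (1ℝ +_) -1≡0 ⟩
      1ℝ + 0ℝ     ≡⟨ +-identityʳ 1ℝ ⟩
      1ℝ          ∎)

module _ (lem : ExcludedMiddle 0ℓ) (ℝ : RealNumbers) (G : SimpleGraph) where
  open RealNumbers ℝ
  open OrderedField ℝ
  open SimpleGraph G

  module Discrete (c : Carrier) (0≤c : 0ℝ ≤ c) where

    discrete : V → V → Carrier
    discrete x y with lem {x ≡ y}
    ... | yes _ = 0ℝ
    ... | no _  = c

    discrete-refl : ∀ x → discrete x x ≡ 0ℝ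
    discrete-refl x with lem {x ≡ x}
    ... | yes _  = refl
    ... | no x≢x = ⊥-elim (x≢x refl)

    discrete-≢ : ∀ {x y} → x ≢ y → discrete x y ≡ c
    discrete-≢ {x} {y} x≢y with lem {x ≡ y}
    ... | yes x≡y = ⊥-elim (x≢y x≡y)
    ... | no _    = refl

    discrete-sym : ∀ x y → discrete x y ≡ discrete y x
    discrete-sym x y with lem {x ≡ y} | lem {y ≡ x}
    ... | yes _   | yes _   = refl
    ... | no _    | no _    = refl
    ... | yes x≡y | no y≢x  = ⊥-elim (y≢x (sym x≡y))
    ... | no x≢y  | yes y≡x = ⊥-elim (x≢y (sym y≡x))

    discrete-≤ : ∀ x y → discrete x y ≤ c
    discrete-≤ x y with lem {x ≡ y}
    ... | yes _ = 0≤c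
    ... | no _  = ≤-refl c

    discrete-nonneg : ∀ x y → 0ℝ ≤ discrete x y
    discrete-nonneg x y with lem {x ≡ y}
    ... | yes _ = ≤-refl 0ℝ
    ... | no _  = 0≤c

    discrete-triangle : ∀ x y z → discrete x z ≤ discrete x y + discrete y z
    discrete-triangle x y z with lem {x ≡ y}
    ... | yes refl = begin
      discrete x z      ≡⟨ +-identityˡ _ ⟨
      0ℝ + discrete x z ∎
    ... | no _ = begin
      discrete x z     ≤⟨ discrete-≤ x z ⟩
      c                ≤⟨ x≤x+y (discrete-nonneg y z) ⟩
      c + discrete y z ∎

    discrete-isPseudometric : IsPseudometric ℝ G discrete
    discrete-isPseudometric = discrete-refl , discrete-sym , discrete-triangle

  pullback-isPseudometric : (d : V → V → Carrier) → IsPseudometric ℝ G d → (f : V → V) →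
                            IsPseudometric ℝ G (λ x y → d (f x) (f y))
  pullback-isPseudometric d (d-refl , d-sym , d-tri) f =
    (λ x → d-refl (f x)) , (λ x y → d-sym (f x) (f y)) , (λ x y z → d-tri (f x) (f y) (f z))

  module Component (a : V) where

    Reach : V → Set
    Reach = Star Adj a

    collapse : V → V → V
    collapse t x with lem {Reach x}
    ... | yes _ = x
    ... | no _  = t

    collapse-reached : ∀ t {x} → Reach x → collapse t x ≡ x
    collapse-reached t {x} ax with lem {Reach x}
    ... | yes _  = refl
    ... | no ¬ax = ⊥-elim (¬ax ax)

    collapse-unreached : ∀ t {x} → ¬ Reach x → collapse t x ≡ t
    collapse-unreached t {x} ¬ax with lem {Reach x}
    ... | yes ax = ⊥-elim (¬ax ax)
    ... | no _   = refl

    collapse-edge : (d : V → V → Carrier) → (∀ x → d x x ≡ 0ℝ) →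
                    ∀ s t {x y} → Adj x y →
                    d (collapse s x) (collapse s y) ≡ d (collapse t x) (collapse t y)
    collapse-edge d d-refl s t {x} {y} xy with lem {Reach x} | lem {Reach y}
    ... | yes _  | yes _  = refl
    ... | no _   | no _   = begin-equality
      d s s ≡⟨ d-refl s ⟩
      0ℝ    ≡⟨ d-refl t ⟨
      d t t ∎
    ... | yes ax | no ¬ay = ⊥-elim (¬ay (ax ◅◅ xy ◅ ε))
    ... | no ¬ax | yes ay = ⊥-elim (¬ax (ay ◅◅ Adj-sym xy ◅ ε))

    reach-all⇒connected : (∀ x → Reach x) → Connected G
    reach-all⇒connected reach u v = reverse Adj-sym (reach u) ◅◅ reach v

  module CollapsedDiscrete {a b : V} (ab : Adj a b) (c : Carrier) (0≤c : 0ℝ ≤ c) where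
    open Discrete c 0≤c
    open Component a

    ρ : V → V → V → Carrier
    ρ t x y = discrete (collapse t x) (collapse t y)

    w : Weight ℝ G
    w {x} {y} _ = ρ a x y

    w-nonneg : NonNegative ℝ G w
    w-nonneg {x} {y} _ = discrete-nonneg (collapse a x) (collapse a y)

    ρ∈𝔐 : ∀ t → In𝔐 ℝ G w (ρ t)
    ρ∈𝔐 t = pullback-isPseudometric discrete discrete-isPseudometric (collapse t)
          , collapse-edge discrete discrete-refl t a

    w-ab : w ab ≡ c
    w-ab = begin-equality
      discrete (collapse a a) (collapse a b) ≡⟨ cong₂ discrete (collapse-reached a ε)
                                                        (collapse-reached a (ab ◅ ε)) ⟩
      discrete a b                           ≡⟨ discrete-≢ (λ { refl → Adj-irrefl ab }) ⟩
      c                                      ∎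

    ρ-reached-unreached : ∀ {t x} → Reach t → ¬ Reach x → ρ t t x ≡ 0ℝ
    ρ-reached-unreached {t} {x} at ¬ax = begin-equality
      discrete (collapse t t) (collapse t x) ≡⟨ cong₂ discrete (collapse-reached t at)
                                                        (collapse-unreached t ¬ax) ⟩
      discrete t t                           ≡⟨ discrete-refl t ⟩
      0ℝ                                     ∎

    least⇒reach-all : HasLeast𝔐 ℝ G w → c ≢ 0ℝ → ∀ x → Reach x
    least⇒reach-all (ρ₀ , ((_ , ρ₀-sym , ρ₀-tri) , ρ₀-w) , ρ₀-least) c≢0 x with lem {Reach x}
    ... | yes ax = ax
    ... | no ¬ax = ⊥-elim (c≢0 (≤-antisym c≤0 0≤c))
      where
      ρ₀-≤0 : ∀ {t} → Reach t → ρ₀ t x ≤ 0ℝ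
      ρ₀-≤0 {t} at = begin
        ρ₀ t x  ≤⟨ ρ₀-least (ρ t) (ρ∈𝔐 t) t x ⟩
        ρ t t x ≡⟨ ρ-reached-unreached at ¬ax ⟩
        0ℝ      ∎

      c≤0 : c ≤ 0ℝ
      c≤0 = begin
        c                ≡⟨ w-ab ⟨
        w ab             ≡⟨ ρ₀-w ab ⟨
        ρ₀ a b           ≤⟨ ρ₀-tri a x b ⟩
        ρ₀ a x + ρ₀ x b  ≡⟨ cong (ρ₀ a x +_) (ρ₀-sym x b) ⟩
        ρ₀ a x + ρ₀ b x  ≤⟨ +-nonpos (ρ₀-≤0 ε) (ρ₀-≤0 (ab ◅ ε)) ⟩
        0ℝ               ∎

lemma4p9 : ExcludedMiddle 0ℓ → (ℝ : RealNumbers) → (G : SimpleGraph) →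
           EdgeSetNonempty G →
           ((w : Weight ℝ G) → NonNegative ℝ G w → Metrizable ℝ G w → HasLeast𝔐 ℝ G w) →
           Connected G
lemma4p9 lem ℝ G (a , b , ab) least with OrderedField.∃-nonneg-nonzero ℝ
... | c , 0≤c , c≢0 =
  reach-all⇒connected (least⇒reach-all (least w w-nonneg (ρ a , ρ∈𝔐 a)) c≢0)
  where
  open Component lem ℝ G a using (reach-all⇒connected)
  open CollapsedDiscrete lem ℝ G ab c 0≤c
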